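{- $\mathbf{LV}$ is not algebraizable.
   Context: $\mathbf{LV}$ is the smallest finitary consequence relation in the language $\{\land,\lor,\to,\mathbin{\Box\!\!\rightarrow},0,1\}$ containing classical propositional axioms and (L1) $\varphi\mathbin{\Box\!\!\rightarrow}\varphi$, (L2) $((\varphi\mathbin{\Box\!\!\rightarrow}\psi)\wedge(\psi\mathbin{\Box\!\!\rightarrow}\varphi))\to((\varphi\mathbin{\Box\!\!\rightarrow}\gamma)\leftrightarrow(\psi\mathbin{\Box\!\!\rightarrow}\gamma))$, (L3) $((\varphi\vee\psi)\mathbin{\Box\!\!\rightarrow}\varphi)\vee((\varphi\vee\psi)\mathbin{\Box\!\!\rightarrow}\psi)\vee(((\varphi\vee\psi)\mathbin{\Box\!\!\rightarrow}\gamma)\leftrightarrow((\varphi\mathbin{\Box\!\!\rightarrow}\gamma)\wedge(\psi\mathbin{\Box\!\!\rightarrow}\gamma)))$, (L4) $(\varphi\mathbin{\Box\!\!\rightarrow}(\psi\land\gamma))\leftrightarrow((\varphi\mathbin{\Box\!\!\rightarrow}\psi)\land(\varphi\mathbin{\Box\!\!\rightarrow}\gamma))$, and closed under modus ponens and the weak rule: if $\vdash\varphi\to\psi$ then $\vdash(\gamma\mathbin{\Box\!\!\rightarrow}\varphi)\to(\gamma\mathbin{\Box\!\!\rightarrow}\psi)$. Algebraizable means in the sense of Blok–Pigozzi: there is a class of algebras $\mathsf K$, a finite set of equations $\tau(x)$ and a finite set of formulas $\Delta(x,y)$ with $\Gamma\vdash\varphi$ iff $\tau(\Gamma)\models_{\mathsf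 K}\tau(\varphi)$, and $x\approx y$ equivalent in $\mathsf K$ to $\tau(\Delta(x,y))$. -}

module Defs where

open import Data.Nat using (ℕ)
open import Data.Fin using (Fin; zero; suc)
open import Data.Bool using (Bool; true; false; _∧_; _∨_; not)
open import Data.List using (List)
open import Data.List.Membership.Propositional using (_∈_)
open import Data.Product using (Σ; _×_; _,_; proj₁; proj₂)
open import Relation.Binary.PropositionalEquality using (_≡_)
open import Relation.Nullary using (¬_)
open import Function.Bundles using (_⇔_)

infixr 7 _∧'_
infixr 6 _∨'_
infixr 5 _⇒_ _□→_ _⇔'_

data Fm (V : Set) : Set where
  var   : V → Fm V
  _∧'_  : Fm V → Fm V → Fm V
  _∨'_  : Fm V → Fm V → Fm V
  _⇒_   : Fm V → Fm V → Fm V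
  _□→_  : Fm V → Fm V → Fm V
  𝟎     : Fm V
  𝟏     : Fm V

_⇔'_ : ∀ {V} → Fm V → Fm V → Fm V
φ ⇔' ψ = (φ ⇒ ψ) ∧' (ψ ⇒ φ)

Formula : Set
Formula = Fm ℕ

sub : ∀ {V W} → (V → Fm W) → Fm V → Fm W
sub σ (var x)  = σ x
sub σ (φ ∧' ψ) = sub σ φ ∧' sub σ ψ
sub σ (φ ∨' ψ) = sub σ φ ∨' sub σ ψ
sub σ (φ ⇒ ψ)  = sub σ φ ⇒ sub σ ψ
sub σ (φ □→ ψ) = sub σ φ □→ sub σ ψ
sub σ 𝟎        = 𝟎
sub σ 𝟏        = 𝟏

-- Classical propositional tautologies: formulas true under every Boolean
-- valuation, where variables and □→-subformulas are treated as atoms.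

evalB : (Formula → Bool) → Formula → Bool
evalB v (var x)  = v (var x)
evalB v (φ ∧' ψ) = evalB v φ ∧ evalB v ψ
evalB v (φ ∨' ψ) = evalB v φ ∨ evalB v ψ
evalB v (φ ⇒ ψ)  = not (evalB v φ) ∨ evalB v ψ
evalB v (φ □→ ψ) = v (φ □→ ψ)
evalB v 𝟎        = false
evalB v 𝟏        = true

Tautology : Formula → Set
Tautology φ = ∀ (v : Formula → Bool) → evalB v φ ≡ true

data Thm : Formula → Set where
  taut : ∀ {φ} → Tautology φ → Thm φ
  L1   : ∀ φ → Thm (φ □→ φ)
  L2   : ∀ φ ψ γ →
         Thm (((φ □→ ψ) ∧' (ψ □→ φ)) ⇒ ((φ □→ γ) ⇔' (ψ □→ γ)))
  L3   : ∀ φ ψ γ →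
         Thm ((((φ ∨' ψ) □→ φ) ∨' ((φ ∨' ψ) □→ ψ))
              ∨' (((φ ∨' ψ) □→ γ) ⇔' ((φ □→ γ) ∧' (ψ □→ γ))))
  L4   : ∀ φ ψ γ →
         Thm ((φ □→ (ψ ∧' γ)) ⇔' ((φ □→ ψ) ∧' (φ □→ γ)))
  mp   : ∀ {φ ψ} → Thm φ → Thm (φ ⇒ ψ) → Thm ψ
  weak : ∀ {φ ψ} γ → Thm (φ ⇒ ψ) → Thm ((γ □→ φ) ⇒ (γ □→ ψ))

infix 4 _⊢_

data _⊢_ (Γ : Formula → Set) : Formula → Set where
  hyp : ∀ {φ} → Γ φ → Γ ⊢ φ
  thm : ∀ {φ} → Thm φ → Γ ⊢ φ
  mp  : ∀ {φ ψ} → Γ ⊢ φ → Γ ⊢ (φ ⇒ ψ) → Γ ⊢ ψ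

record Alg : Set₁ where
  field
    Carrier : Set
    meet join imp cf : Carrier → Carrier → Carrier
    zer one : Carrier

⟦_⟧ : ∀ {V} → Fm V → (A : Alg) → (V → Alg.Carrier A) → Alg.Carrier A
⟦ var x ⟧  A h = h x
⟦ φ ∧' ψ ⟧ A h = Alg.meet A (⟦ φ ⟧ A h) (⟦ ψ ⟧ A h)
⟦ φ ∨' ψ ⟧ A h = Alg.join A (⟦ φ ⟧ A h) (⟦ ψ ⟧ A h)
⟦ φ ⇒ ψ ⟧  A h = Alg.imp A (⟦ φ ⟧ A h) (⟦ ψ ⟧ A h)
⟦ φ □→ ψ ⟧ A h = Alg.cf A (⟦ φ ⟧ A h) (⟦ ψ ⟧ A h)
⟦ 𝟎 ⟧      A h = Alg.zer A
⟦ 𝟏 ⟧      A h = Alg.one A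

-- an equation in one variable x (= var zero)
Eq1 : Set
Eq1 = Fm (Fin 1) × Fm (Fin 1)

τHolds : List Eq1 → (A : Alg) → (ℕ → Alg.Carrier A) → Formula → Set
τHolds τ A h φ = ∀ {e} → e ∈ τ →
  ⟦ sub (λ _ → φ) (proj₁ e) ⟧ A h ≡ ⟦ sub (λ _ → φ) (proj₂ e) ⟧ A h

_⊨[_,_]_ : (Formula → Set) → (Alg → Set) → List Eq1 → Formula → Set₁
Γ ⊨[ K , τ ] φ = ∀ (A : Alg) → K A → ∀ (h : ℕ → Alg.Carrier A) →
  (∀ {γ} → Γ γ → τHolds τ A h γ) → τHolds τ A h φ

pair : ∀ {C : Set} → C → C → Fin 2 → C
pair a b zero    = a
pair a b (suc _) = b

τΔHolds : List Eq1 → List (Fm (Fin 2)) → (A : Alg) → (a b : Alg.Carrier A) → Set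
τΔHolds τ Δ A a b = ∀ {e} → e ∈ τ → ∀ {ψ} → ψ ∈ Δ →
  ⟦ proj₁ e ⟧ A (λ _ → ⟦ ψ ⟧ A (pair a b)) ≡ ⟦ proj₂ e ⟧ A (λ _ → ⟦ ψ ⟧ A (pair a b))

Algebraizable : ((Formula → Set) → Formula → Set) → Set₁
Algebraizable _⊢'_ =
  Σ (Alg → Set) λ K → Σ (List Eq1) λ τ → Σ (List (Fm (Fin 2))) λ Δ →
    (∀ (Γ : Formula → Set) (φ : Formula) → (Γ ⊢' φ → Γ ⊨[ K , τ ] φ) × (Γ ⊨[ K , τ ] φ → Γ ⊢' φ))
    × (∀ (A : Alg) → K A → ∀ (a b : Alg.Carrier A) →
         (a ≡ b → τΔHolds τ Δ A a b) × (τΔHolds τ Δ A a b → a ≡ b))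

{-# OPTIONS --safe #-}
-- Algebraizability makes Δ(p,q) behave like an equality: each θ(p,p) with θ ∈ Δ is a theorem,
-- and Δ(p,q), χ(p) ⊢ χ(q). Reading φ □→ ψ as "φ → ψ holds at the next world" on the worlds ℕ
-- is sound for LV, and then a formula of □→-depth d evaluated at world 0 only sees the worlds
-- 0, …, d. Take p true everywhere and q true exactly before N, with N beyond the depths of Δ.
-- At world 0 the formulas of Δ(p,q) cannot tell q from p, so they hold like the theorems
-- Δ(p,p); so does □ᴺp = 𝟏 □→ ⋯ 𝟏 □→ p, but □ᴺq fails.
module Submission where

open import Data.Bool using (Bool; true; false; _∧_; _∨_; not)
open import Data.Bool.Properties using (∨-inverseˡ)
open import Data.Fin using (Fin; zero; suc)
open import Data.List using (List; map)
open import Data.List.Extrema.Nat using (max; xs≤max)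
open import Data.List.Membership.Propositional using (_∈_)
open import Data.List.Membership.Propositional.Properties using (∈-map⁺; ∈-map⁻)
open import Data.List.Relation.Unary.All using (lookup)
open import Data.Nat using (ℕ; zero; suc; _+_; _⊔_; _≤_; _<?_; s≤s)
open import Data.Nat.Properties using (≤-trans; ≤-reflexive; m≤m+n; m≤m⊔n; m≤n⊔m; +-suc; +-identityʳ; <-irrefl)
open import Data.Product using (_,_; proj₁; proj₂)
open import Data.Sum using (inj₁; inj₂)
open import Relation.Binary.PropositionalEquality
open import Relation.Nullary using (¬_; contradiction)
open import Relation.Nullary.Decidable using (does; dec-true; dec-false)
open import Relation.Unary using (∅; ｛_｝; _∪_)

open import Defs

infixr 5 _⇒ᵇ_ _⇔ᵇ_

_⇒ᵇ_ : Bool → Bool → Bool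
a ⇒ᵇ b = not a ∨ b

_⇔ᵇ_ : Bool → Bool → Bool
a ⇔ᵇ b = (a ⇒ᵇ b) ∧ (b ⇒ᵇ a)

depth : ∀ {V} → Fm V → ℕ
depth (var x)  = 0
depth (φ ∧' ψ) = depth φ ⊔ depth ψ
depth (φ ∨' ψ) = depth φ ⊔ depth ψ
depth (φ ⇒ ψ)  = depth φ ⊔ depth ψ
depth (φ □→ ψ) = suc (depth φ ⊔ depth ψ)
depth 𝟎        = 0
depth 𝟏        = 0

next : ∀ {V} → ℕ → Fm V → Fm V
next zero    φ = φ
next (suc n) φ = next n (𝟏 □→ φ)

eval : ∀ {V} → (V → ℕ → Bool) → Fm V → ℕ → Bool
eval v (var x)  w = v x w
eval v (φ ∧' ψ) w = eval v φ w ∧ eval v ψ w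
eval v (φ ∨' ψ) w = eval v φ w ∨ eval v ψ w
eval v (φ ⇒ ψ)  w = eval v φ w ⇒ᵇ eval v ψ w
eval v (φ □→ ψ) w = eval v φ (suc w) ⇒ᵇ eval v ψ (suc w)
eval v 𝟎        w = false
eval v 𝟏        w = true

evalB-eval : ∀ v w φ → evalB (λ χ → eval v χ w) φ ≡ eval v φ w
evalB-eval v w (var x)  = refl
evalB-eval v w (φ ∧' ψ) = cong₂ _∧_ (evalB-eval v w φ) (evalB-eval v w ψ)
evalB-eval v w (φ ∨' ψ) = cong₂ _∨_ (evalB-eval v w φ) (evalB-eval v w ψ)
evalB-eval v w (φ ⇒ ψ)  = cong₂ _⇒ᵇ_ (evalB-eval v w φ) (evalB-eval v w ψ)
evalB-eval v w (φ □→ ψ) = refl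
evalB-eval v w 𝟎        = refl
evalB-eval v w 𝟏        = refl

⇒ᵇ-mp : ∀ {a b} → a ≡ true → a ⇒ᵇ b ≡ true → b ≡ true
⇒ᵇ-mp refl b≡true = b≡true

Thm-valid : ∀ {φ} → Thm φ → ∀ v w → eval v φ w ≡ true
Thm-valid {φ} (taut t)   v w = trans (sym (evalB-eval v w φ)) (t (λ χ → eval v χ w))
Thm-valid (L1 φ)         v w = ∨-inverseˡ (eval v φ (suc w))
Thm-valid (L2 φ ψ γ)     v w = L2-valid (eval v φ (suc w)) (eval v ψ (suc w)) (eval v γ (suc w))
  where
  L2-valid : ∀ a b c → ((a ⇒ᵇ b) ∧ (b ⇒ᵇ a)) ⇒ᵇ ((a ⇒ᵇ c) ⇔ᵇ (b ⇒ᵇ c)) ≡ true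
  L2-valid true  true  true  = refl
  L2-valid true  true  false = refl
  L2-valid true  false c     = refl
  L2-valid false true  c     = refl
  L2-valid false false c     = refl
Thm-valid (L3 φ ψ γ)     v w = L3-valid (eval v φ (suc w)) (eval v ψ (suc w)) (eval v γ (suc w))
  where
  L3-valid : ∀ a b c → (((a ∨ b) ⇒ᵇ a) ∨ ((a ∨ b) ⇒ᵇ b))
                       ∨ (((a ∨ b) ⇒ᵇ c) ⇔ᵇ ((a ⇒ᵇ c) ∧ (b ⇒ᵇ c))) ≡ true
  L3-valid true  b     c = refl
  L3-valid false true  c = refl
  L3-valid false false c = refl
Thm-valid (L4 φ ψ γ)     v w = L4-valid (eval v φ (suc w)) (eval v ψ (suc w)) (eval v γ (suc w))
  where
  L4-valid : ∀ a b c → (a ⇒ᵇ (b ∧ c)) ⇔ᵇ ((a ⇒ᵇ b) ∧ (a ⇒ᵇ c)) ≡ true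
  L4-valid true  true  true  = refl
  L4-valid true  true  false = refl
  L4-valid true  false c     = refl
  L4-valid false b     c     = refl
Thm-valid (mp t s)       v w = ⇒ᵇ-mp (Thm-valid t v w) (Thm-valid s v w)
Thm-valid (weak {φ} {ψ} γ t) v w =
  weak-valid (eval v γ (suc w)) (eval v φ (suc w)) (eval v ψ (suc w)) (Thm-valid t v (suc w))
  where
  weak-valid : ∀ c a b → a ⇒ᵇ b ≡ true → (c ⇒ᵇ a) ⇒ᵇ (c ⇒ᵇ b) ≡ true
  weak-valid true  true  b e = e
  weak-valid true  false b e = refl
  weak-valid false a     b e = refl

⊢-sound : ∀ {Γ φ} → Γ ⊢ φ → ∀ v w → (∀ {γ} → Γ γ → eval v γ w ≡ true) → eval v φ w ≡ true
⊢-sound (hyp γ∈Γ) v w Γ-true = Γ-true γ∈Γ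
⊢-sound (thm t)   v w Γ-true = Thm-valid t v w
⊢-sound (mp d e)  v w Γ-true = ⇒ᵇ-mp (⊢-sound d v w Γ-true) (⊢-sound e v w Γ-true)

eval-sub : ∀ {V W} (σ : V → Fm W) v φ w → eval v (sub σ φ) w ≡ eval (λ x → eval v (σ x)) φ w
eval-sub σ v (var x)  w = refl
eval-sub σ v (φ ∧' ψ) w = cong₂ _∧_ (eval-sub σ v φ w) (eval-sub σ v ψ w)
eval-sub σ v (φ ∨' ψ) w = cong₂ _∨_ (eval-sub σ v φ w) (eval-sub σ v ψ w)
eval-sub σ v (φ ⇒ ψ)  w = cong₂ _⇒ᵇ_ (eval-sub σ v φ w) (eval-sub σ v ψ w)
eval-sub σ v (φ □→ ψ) w = cong₂ _⇒ᵇ_ (eval-sub σ v φ (suc w)) (eval-sub σ v ψ (suc w))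
eval-sub σ v 𝟎        w = refl
eval-sub σ v 𝟏        w = refl

eval-local : ∀ {V} {v v' : V → ℕ → Bool} φ {k} w → depth φ ≤ k →
             (∀ x {u} → u ≤ w + k → v x u ≡ v' x u) → eval v φ w ≡ eval v' φ w
eval-local (var x) {k} w _ v≡v' = v≡v' x (m≤m+n w k)
eval-local (φ ∧' ψ) w d≤k v≡v' =
  cong₂ _∧_ (eval-local φ w (≤-trans (m≤m⊔n _ _) d≤k) v≡v') (eval-local ψ w (≤-trans (m≤n⊔m _ _) d≤k) v≡v')
eval-local (φ ∨' ψ) w d≤k v≡v' =
  cong₂ _∨_ (eval-local φ w (≤-trans (m≤m⊔n _ _) d≤k) v≡v') (eval-local ψ w (≤-trans (m≤n⊔m _ _) d≤k) v≡v')
eval-local (φ ⇒ ψ) w d≤k v≡v' =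
  cong₂ _⇒ᵇ_ (eval-local φ w (≤-trans (m≤m⊔n _ _) d≤k) v≡v') (eval-local ψ w (≤-trans (m≤n⊔m _ _) d≤k) v≡v')
eval-local {v = v} {v'} (φ □→ ψ) {suc k} w (s≤s d≤k) v≡v' =
  cong₂ _⇒ᵇ_ (eval-local φ (suc w) (≤-trans (m≤m⊔n _ _) d≤k) v≡v'-shifted)
             (eval-local ψ (suc w) (≤-trans (m≤n⊔m _ _) d≤k) v≡v'-shifted)
  where
  v≡v'-shifted : ∀ x {u} → u ≤ suc w + k → v x u ≡ v' x u
  v≡v'-shifted x u≤ = v≡v' x (≤-trans u≤ (≤-reflexive (sym (+-suc w k))))
eval-local 𝟎 w _ _ = refl
eval-local 𝟏 w _ _ = refl

eval-next : ∀ {V} v n (φ : Fm V) w → eval v (next n φ) w ≡ eval v φ (n + w)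
eval-next v zero    φ w = refl
eval-next v (suc n) φ w = eval-next v n (𝟏 □→ φ) w

module _ (A : Alg) where
  open Alg A

  ⟦⟧-cong : ∀ {V} (φ : Fm V) {g g' : V → Carrier} → (∀ x → g x ≡ g' x) → ⟦ φ ⟧ A g ≡ ⟦ φ ⟧ A g'
  ⟦⟧-cong (var x)  g≡g' = g≡g' x
  ⟦⟧-cong (φ ∧' ψ) g≡g' = cong₂ meet (⟦⟧-cong φ g≡g') (⟦⟧-cong ψ g≡g')
  ⟦⟧-cong (φ ∨' ψ) g≡g' = cong₂ join (⟦⟧-cong φ g≡g') (⟦⟧-cong ψ g≡g')
  ⟦⟧-cong (φ ⇒ ψ)  g≡g' = cong₂ imp (⟦⟧-cong φ g≡g') (⟦⟧-cong ψ g≡g')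
  ⟦⟧-cong (φ □→ ψ) g≡g' = cong₂ cf (⟦⟧-cong φ g≡g') (⟦⟧-cong ψ g≡g')
  ⟦⟧-cong 𝟎        g≡g' = refl
  ⟦⟧-cong 𝟏        g≡g' = refl

  ⟦sub⟧ : ∀ {V W} (σ : V → Fm W) φ h → ⟦ sub σ φ ⟧ A h ≡ ⟦ φ ⟧ A (λ x → ⟦ σ x ⟧ A h)
  ⟦sub⟧ σ (var x)  h = refl
  ⟦sub⟧ σ (φ ∧' ψ) h = cong₂ meet (⟦sub⟧ σ φ h) (⟦sub⟧ σ ψ h)
  ⟦sub⟧ σ (φ ∨' ψ) h = cong₂ join (⟦sub⟧ σ φ h) (⟦sub⟧ σ ψ h)
  ⟦sub⟧ σ (φ ⇒ ψ)  h = cong₂ imp (⟦sub⟧ σ φ h) (⟦sub⟧ σ ψ h)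
  ⟦sub⟧ σ (φ □→ ψ) h = cong₂ cf (⟦sub⟧ σ φ h) (⟦sub⟧ σ ψ h)
  ⟦sub⟧ σ 𝟎        h = refl
  ⟦sub⟧ σ 𝟏        h = refl

  ⟦sub⟧-cong : ∀ {V W} {σ σ' : V → Fm W} φ h → (∀ x → ⟦ σ x ⟧ A h ≡ ⟦ σ' x ⟧ A h) →
               ⟦ sub σ φ ⟧ A h ≡ ⟦ sub σ' φ ⟧ A h
  ⟦sub⟧-cong {σ = σ} {σ'} φ h σ≡σ' = begin
    ⟦ sub σ φ ⟧ A h                  ≡⟨ ⟦sub⟧ σ φ h ⟩
    ⟦ φ ⟧ A (λ x → ⟦ σ x ⟧ A h)      ≡⟨ ⟦⟧-cong φ σ≡σ' ⟩
    ⟦ φ ⟧ A (λ x → ⟦ σ' x ⟧ A h)     ≡⟨ ⟦sub⟧ σ' φ h ⟨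
    ⟦ sub σ' φ ⟧ A h                 ∎
    where open ≡-Reasoning

  ⟦sub-pair⟧ : ∀ {W} (φ ψ : Fm W) θ h →
               ⟦ sub (pair φ ψ) θ ⟧ A h ≡ ⟦ θ ⟧ A (pair (⟦ φ ⟧ A h) (⟦ ψ ⟧ A h))
  ⟦sub-pair⟧ φ ψ θ h = trans (⟦sub⟧ (pair φ ψ) θ h) (⟦⟧-cong θ ⟦pair⟧)
    where
    ⟦pair⟧ : ∀ x → ⟦ pair φ ψ x ⟧ A h ≡ pair (⟦ φ ⟧ A h) (⟦ ψ ⟧ A h) x
    ⟦pair⟧ zero    = refl
    ⟦pair⟧ (suc _) = refl

  τHoldsAt : List Eq1 → Carrier → Set
  τHoldsAt τ c = ∀ {e} → e ∈ τ → ⟦ proj₁ e ⟧ A (λ _ → c) ≡ ⟦ proj₂ e ⟧ A (λ _ → c)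

  τHolds⇒τHoldsAt : ∀ {τ h} φ → τHolds τ A h φ → τHoldsAt τ (⟦ φ ⟧ A h)
  τHolds⇒τHoldsAt {h = h} φ τφ {l , r} e∈τ =
    trans (sym (⟦sub⟧ (λ _ → φ) l h)) (trans (τφ e∈τ) (⟦sub⟧ (λ _ → φ) r h))

  τHoldsAt⇒τHolds : ∀ {τ h} φ → τHoldsAt τ (⟦ φ ⟧ A h) → τHolds τ A h φ
  τHoldsAt⇒τHolds {h = h} φ τφ {l , r} e∈τ =
    trans (⟦sub⟧ (λ _ → φ) l h) (trans (τφ e∈τ) (sym (⟦sub⟧ (λ _ → φ) r h)))

_⟨_,_⟩ : List (Fm (Fin 2)) → Formula → Formula → Formula → Set
Δ ⟨ φ , ψ ⟩ = _∈ map (sub (pair φ ψ)) Δ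

module _ {K : Alg → Set} {τ : List Eq1} {Δ : List (Fm (Fin 2))}
         (⊨⇒⊢ : ∀ Γ φ → Γ ⊨[ K , τ ] φ → Γ ⊢ φ) where

  Δ-refl : (∀ A → K A → ∀ a → τΔHolds τ Δ A a a) → ∀ φ {θ} → θ ∈ Δ → ∅ ⊢ sub (pair φ φ) θ
  Δ-refl τΔ-refl φ {θ} θ∈Δ = ⊨⇒⊢ ∅ _ λ A KA h _ →
    τHoldsAt⇒τHolds A (sub (pair φ φ) θ)
      (subst (τHoldsAt A τ) (sym (⟦sub-pair⟧ A φ φ θ h)) (λ e∈τ → τΔ-refl A KA (⟦ φ ⟧ A h) e∈τ θ∈Δ))

  Δ-replacement : (∀ A → K A → ∀ a b → τΔHolds τ Δ A a b → a ≡ b) → ∀ φ ψ (χ : Fm (Fin 1)) →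
                  Δ ⟨ φ , ψ ⟩ ∪ ｛ sub (λ _ → φ) χ ｝ ⊢ sub (λ _ → ψ) χ
  Δ-replacement τΔ⇒≡ φ ψ χ = ⊨⇒⊢ _ _ replacement-valid
    where
    replacement-valid : (Δ ⟨ φ , ψ ⟩ ∪ ｛ sub (λ _ → φ) χ ｝) ⊨[ K , τ ] sub (λ _ → ψ) χ
    replacement-valid A KA h hyps =
      τHoldsAt⇒τHolds A _ (subst (τHoldsAt A τ) χφ≡χψ (τHolds⇒τHoldsAt A _ (hyps (inj₂ refl))))
      where
      τΔ : τΔHolds τ Δ A (⟦ φ ⟧ A h) (⟦ ψ ⟧ A h)
      τΔ e∈τ {θ} θ∈Δ = subst (τHoldsAt A τ) (⟦sub-pair⟧ A φ ψ θ h)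
                         (τHolds⇒τHoldsAt A _ (hyps (inj₁ (∈-map⁺ _ θ∈Δ)))) e∈τ
      χφ≡χψ : ⟦ sub (λ _ → φ) χ ⟧ A h ≡ ⟦ sub (λ _ → ψ) χ ⟧ A h
      χφ≡χψ = ⟦sub⟧-cong A χ h (λ _ → τΔ⇒≡ A KA _ _ τΔ)

maxDepth : ∀ {V} → List (Fm V) → ℕ
maxDepth Δ = max 0 (map depth Δ)

depth≤maxDepth : ∀ {V} {Δ : List (Fm V)} {θ} → θ ∈ Δ → depth θ ≤ maxDepth Δ
depth≤maxDepth {Δ = Δ} θ∈Δ = lookup (xs≤max 0 (map depth Δ)) (∈-map⁺ depth θ∈Δ)

p q : Formula
p = var 0
q = var 1

countermodel : ℕ → ℕ → ℕ → Bool
countermodel N 1 u = does (u <? N)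
countermodel N _ u = true

countermodel-Δpq : ∀ Δ → (∀ {θ} → θ ∈ Δ → ∅ ⊢ sub (pair p p) θ) →
                   ∀ {γ} → (Δ ⟨ p , q ⟩) γ → eval (countermodel (suc (maxDepth Δ))) γ 0 ≡ true
countermodel-Δpq Δ ⊢Δpp γ∈Δpq with ∈-map⁻ _ γ∈Δpq
... | θ , θ∈Δ , refl = begin
  eval v (sub (pair p q) θ) 0            ≡⟨ eval-sub (pair p q) v θ 0 ⟩
  eval (λ x → eval v (pair p q x)) θ 0   ≡⟨ eval-local θ 0 (depth≤maxDepth θ∈Δ) q≡p-before-N ⟩
  eval (λ x → eval v (pair p p x)) θ 0   ≡⟨ eval-sub (pair p p) v θ 0 ⟨
  eval v (sub (pair p p) θ) 0            ≡⟨ ⊢-sound (⊢Δpp θ∈Δ) v 0 (λ ()) ⟩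
  true                                   ∎
  where
  open ≡-Reasoning
  v : ℕ → ℕ → Bool
  v = countermodel (suc (maxDepth Δ))
  q≡p-before-N : ∀ x {u} → u ≤ maxDepth Δ → eval v (pair p q x) u ≡ eval v (pair p p x) u
  q≡p-before-N zero    _   = refl
  q≡p-before-N (suc _) u≤N = dec-true (_ <? _) (s≤s u≤N)

corollary4p20 : ¬ Algebraizable _⊢_
corollary4p20 (K , τ , Δ , ⊢⇔⊨ , ≡⇔τΔ) = contradiction (trans (sym □ᴺq-false) □ᴺq-true) λ ()
  where
  N : ℕ
  N = suc (maxDepth Δ)
  v : ℕ → ℕ → Bool
  v = countermodel N
  □ᴺx : Fm (Fin 1)
  □ᴺx = next N (var zero)
  ⊨⇒⊢ : ∀ Γ φ → Γ ⊨[ K , τ ] φ → Γ ⊢ φ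
  ⊨⇒⊢ Γ φ = proj₂ (⊢⇔⊨ Γ φ)
  ⊢Δpp : ∀ {θ} → θ ∈ Δ → ∅ ⊢ sub (pair p p) θ
  ⊢Δpp = Δ-refl ⊨⇒⊢ (λ A KA a → proj₁ (≡⇔τΔ A KA a a) refl) p
  eval-□ᴺ : ∀ x → eval v (sub (λ _ → var x) □ᴺx) 0 ≡ v x (N + 0)
  eval-□ᴺ x = trans (eval-sub _ v □ᴺx 0) (eval-next _ N (var zero) 0)
  hyps-true : ∀ {γ} → (Δ ⟨ p , q ⟩ ∪ ｛ sub (λ _ → p) □ᴺx ｝) γ → eval v γ 0 ≡ true
  hyps-true (inj₁ γ∈Δpq) = countermodel-Δpq Δ ⊢Δpp γ∈Δpq
  hyps-true (inj₂ refl)  = eval-□ᴺ 0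
  □ᴺq-true : eval v (sub (λ _ → q) □ᴺx) 0 ≡ true
  □ᴺq-true = ⊢-sound (Δ-replacement ⊨⇒⊢ (λ A KA a b → proj₂ (≡⇔τΔ A KA a b)) p q □ᴺx) v 0 hyps-true
  □ᴺq-false : eval v (sub (λ _ → q) □ᴺx) 0 ≡ false
  □ᴺq-false = trans (eval-□ᴺ 1) (dec-false (N + 0 <? N) (<-irrefl (+-identityʳ N)))
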